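{- Let $G=(V,E)$ be a finite connected simple graph and let $S$ be a set of placements on $G$. Suppose the players may agree on a strategy before the game starts. Then there exists a correct strategy in the simultaneous variant under which, in every placement of $S$, at least one player eventually announces their position, if and only if there exists such a correct strategy in the alternating variant. In other words, the set of placements that can be correctly guessed is the same in both variants.
   Context: The game: two players $A$ and $B$ are placed on the endpoints of an edge; a placement is an ordered pair $(a,b)$ with $\{a,b\}\in E$, meaning $A$ sits at $a$ and $B$ at $b$. Each player knows $G$ and the vertex of the other player, but not their own vertex. Time proceeds in discrete steps $t=1,2,\dots$. In the simultaneous variant, at each step each player either stays silent or announces a vertex (claiming it is their own position), both acting at the same time. In the alternating variant, $A$ may speak only at odd steps and $B$ only at even steps. All announcements are heard by both players. A strategy specifies for each player, as a function of $G$, the other player's vertex and the history of announcements so far, whether to stay silent or which vertex to announce at each step. A strategy is correct if in every placement, whenever a player announces a vertex, it is that player's actual position. -}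

module Defs where

open import Data.Nat using (ℕ; zero; suc)
open import Data.Bool using (Bool; true; false; not)
open import Data.Fin using (Fin)
open import Data.Maybe using (Maybe; just; nothing)
open import Data.Vec using (Vec; []; _∷_)
open import Data.Product using (_×_; _,_; proj₁; proj₂; ∃)
open import Data.Sum using (_⊎_)
open import Relation.Nullary using (¬_)
open import Relation.Binary.PropositionalEquality using (_≡_)
open import Relation.Binary.Construct.Closure.ReflexiveTransitive using (Star)

record ConnectedSimpleGraph (n : ℕ) : Set₁ where
  field
    Adj       : Fin n → Fin n → Set
    symmetric : ∀ {u v} → Adj u v → Adj v u
    irreflex  : ∀ {u} → ¬ Adj u u
    connected : ∀ u v → Star Adj u v

-- An announcement at one step: nothing = silent, just v = "my position is v".
Action : ℕ → Set
Action n = Maybe (Fin n)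

-- Simultaneous variant.
-- Step t+1 (t = 0,1,...) is played with a history of the t previous steps
-- (most recent first), each entry being (A's action , B's action).
SimHistory : ℕ → ℕ → Set
SimHistory n t = Vec (Action n × Action n) t

-- A player's strategy: from the other player's vertex, the step index and
-- the history so far, decide what to do.  (G is fixed.)
SimPlayerStrategy : ℕ → Set
SimPlayerStrategy n = Fin n → (t : ℕ) → SimHistory n t → Action n

SimStrategy : ℕ → Set
SimStrategy n = SimPlayerStrategy n × SimPlayerStrategy n

simHistory : ∀ {n} → SimStrategy n → Fin n → Fin n → (t : ℕ) → SimHistory n t
simHistory σ a b zero = []
simHistory σ a b (suc t) =
  let h = simHistory σ a b t in
  (proj₁ σ b t h , proj₂ σ a t h) ∷ h

simActA simActB : ∀ {n} → SimStrategy n → Fin n → Fin n → ℕ → Action n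
simActA σ a b t = proj₁ σ b t (simHistory σ a b t)
simActB σ a b t = proj₂ σ a t (simHistory σ a b t)

SimCorrect : ∀ {n} → ConnectedSimpleGraph n → SimStrategy n → Set
SimCorrect {n} G σ = ∀ (a b : Fin n) → ConnectedSimpleGraph.Adj G a b → ∀ t →
  (∀ v → simActA σ a b t ≡ just v → v ≡ a) ×
  (∀ v → simActB σ a b t ≡ just v → v ≡ b)

SimSomeoneAnnounces : ∀ {n} → SimStrategy n → Fin n → Fin n → Set
SimSomeoneAnnounces σ a b =
  ∃ λ t → (∃ λ v → simActA σ a b t ≡ just v) ⊎ (∃ λ v → simActB σ a b t ≡ just v)

isEven : ℕ → Bool
isEven zero = true
isEven (suc t) = not (isEven t)

-- Steps are 1,2,3,...; here index t = 0,1,2,... stands for step t+1, so A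
-- speaks at even t (odd steps) and B at odd t (even steps).
-- The history before step t+1 lists the t earlier announcements (most recent
-- first); an entry is the action of whoever was entitled to speak then.
AltHistory : ℕ → ℕ → Set
AltHistory n t = Vec (Action n) t

-- A player's strategy; its value is only consulted at that player's own steps.
AltPlayerStrategy : ℕ → Set
AltPlayerStrategy n = Fin n → (t : ℕ) → AltHistory n t → Action n

AltStrategy : ℕ → Set
AltStrategy n = AltPlayerStrategy n × AltPlayerStrategy n

altMoveA altMoveB : ∀ {n} → AltStrategy n → Fin n → Fin n →
                    (t : ℕ) → AltHistory n t → Action n
altMoveA σ a b t h with isEven t
... | true = proj₁ σ b t h
... | false = nothing
altMoveB σ a b t h with isEven t
... | true = nothing
... | false = proj₂ σ a t h

altHistory : ∀ {n} → AltStrategy n → Fin n → Fin n → (t : ℕ) → AltHistory n t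
altHistory σ a b zero = []
altHistory σ a b (suc t) with isEven t
... | true = proj₁ σ b t (altHistory σ a b t) ∷ altHistory σ a b t
... | false = proj₂ σ a t (altHistory σ a b t) ∷ altHistory σ a b t

altActA altActB : ∀ {n} → AltStrategy n → Fin n → Fin n → ℕ → Action n
altActA σ a b t = altMoveA σ a b t (altHistory σ a b t)
altActB σ a b t = altMoveB σ a b t (altHistory σ a b t)

AltCorrect : ∀ {n} → ConnectedSimpleGraph n → AltStrategy n → Set
AltCorrect {n} G σ = ∀ (a b : Fin n) → ConnectedSimpleGraph.Adj G a b → ∀ t →
  (∀ v → altActA σ a b t ≡ just v → v ≡ a) ×
  (∀ v → altActB σ a b t ≡ just v → v ≡ b)

AltSomeoneAnnounces : ∀ {n} → AltStrategy n → Fin n → Fin n → Set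
AltSomeoneAnnounces σ a b =
  ∃ λ t → (∃ λ v → altActA σ a b t ≡ just v) ⊎ (∃ λ v → altActB σ a b t ≡ just v)

IsPlacementSet : ∀ {n} → ConnectedSimpleGraph n → (Fin n → Fin n → Set) → Set
IsPlacementSet {n} G S = ∀ (a b : Fin n) → S a b → ConnectedSimpleGraph.Adj G a b

SimSolvable : ∀ {n} → ConnectedSimpleGraph n → (Fin n → Fin n → Set) → Set
SimSolvable {n} G S = ∃ λ (σ : SimStrategy n) →
  SimCorrect G σ × (∀ (a b : Fin n) → S a b → SimSomeoneAnnounces σ a b)

AltSolvable : ∀ {n} → ConnectedSimpleGraph n → (Fin n → Fin n → Set) → Set
AltSolvable {n} G S = ∃ λ (σ : AltStrategy n) →
  AltCorrect G σ × (∀ (a b : Fin n) → S a b → AltSomeoneAnnounces σ a b)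

-- Both correctness and the success condition only depend on which vertices each
-- player ever announces in each placement, not on when.  An alternating strategy
-- is run unchanged in the simultaneous game, the player not entitled to speak
-- staying silent.  Conversely, simultaneous round k is played as alternating
-- steps 2k (A) and 2k+1 (B), where B ignores A's announcement of the same round;
-- the announcements are then exactly those of the simultaneous play.
module Submission where

open import Defs
open import Data.Nat using (ℕ; zero; suc)
open import Data.Fin using (Fin)
open import Data.Bool using (true; false; if_then_else_)
open import Data.Bool.Properties using (not-involutive)
open import Data.Maybe using (just; nothing)
open import Data.Vec using ([]; _∷_; tail)
open import Data.Product using (_×_; _,_; proj₁; proj₂; ∃)
open import Data.Sum using (_⊎_; inj₁; inj₂)
open import Function using (id; _∘_; case_of_)
open import Relation.Binary.PropositionalEquality
  using (_≡_; refl; sym; trans; cong; cong₂; module ≡-Reasoning)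
open ≡-Reasoning

double : ℕ → ℕ
double zero = zero
double (suc k) = suc (suc (double k))

data EvenOdd : ℕ → Set where
  even : ∀ k → EvenOdd (double k)
  odd  : ∀ k → EvenOdd (suc (double k))

evenOdd : ∀ t → EvenOdd t
evenOdd zero = even zero
evenOdd (suc t) with evenOdd t
... | even k = odd k
... | odd k = even (suc k)

evenOdd-double : ∀ k → evenOdd (double k) ≡ even k
evenOdd-suc-double : ∀ k → evenOdd (suc (double k)) ≡ odd k
evenOdd-double zero = refl
evenOdd-double (suc k) rewrite evenOdd-suc-double k = refl
evenOdd-suc-double k rewrite evenOdd-double k = refl

isEven-double : ∀ k → isEven (double k) ≡ true
isEven-double zero = refl
isEven-double (suc k) rewrite not-involutive (isEven (double k)) = isEven-double k

isEven-suc-double : ∀ k → isEven (suc (double k)) ≡ false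
isEven-suc-double k rewrite isEven-double k = refl

module _ {n : ℕ} where

  open ConnectedSimpleGraph using (Adj)

  Actions : Set
  Actions = Fin n → Fin n → ℕ → Action n

  -- SimCorrect G σ is definitionally Truthful G (simActA σ) (simActB σ), and
  -- similarly for AltCorrect and for Live against the two Solvable predicates.
  Truthful : ConnectedSimpleGraph n → Actions → Actions → Set
  Truthful G α β = ∀ a b → Adj G a b → ∀ t →
    (∀ v → α a b t ≡ just v → v ≡ a) × (∀ v → β a b t ≡ just v → v ≡ b)

  Live : (Fin n → Fin n → Set) → Actions → Actions → Set
  Live S α β = ∀ a b → S a b →
    ∃ λ t → (∃ λ v → α a b t ≡ just v) ⊎ (∃ λ v → β a b t ≡ just v)

  _⊑_ : Actions → Actions → Set
  α ⊑ β = ∀ a b t v → α a b t ≡ just v → ∃ λ s → β a b s ≡ just v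

  reindex⇒⊑ : ∀ {α β} (f : ℕ → ℕ) → (∀ a b t → α a b t ≡ β a b (f t)) → α ⊑ β
  reindex⇒⊑ f eq a b t v e = f t , trans (sym (eq a b t)) e

  Truthful-⊑ : ∀ {G α β α′ β′} → α′ ⊑ α → β′ ⊑ β → Truthful G α β → Truthful G α′ β′
  Truthful-⊑ α′⊑α β′⊑β truthful a b adj t =
      (λ v e → let s , e′ = α′⊑α a b t v e in proj₁ (truthful a b adj s) v e′)
    , (λ v e → let s , e′ = β′⊑β a b t v e in proj₂ (truthful a b adj s) v e′)

  Live-⊑ : ∀ {S α β α′ β′} → α ⊑ α′ → β ⊑ β′ → Live S α β → Live S α′ β′
  Live-⊑ α⊑α′ β⊑β′ live a b s with live a b s
  ... | t , inj₁ (v , e) = let t′ , e′ = α⊑α′ a b t v e in t′ , inj₁ (v , e′)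
  ... | t , inj₂ (v , e) = let t′ , e′ = β⊑β′ a b t v e in t′ , inj₂ (v , e′)

  module _ (σ : AltStrategy n) (a b : Fin n) (k : ℕ) where

    altActA-even : altActA σ a b (double k) ≡ proj₁ σ b (double k) (altHistory σ a b (double k))
    altActA-even rewrite isEven-double k = refl

    altActB-even : altActB σ a b (double k) ≡ nothing
    altActB-even rewrite isEven-double k = refl

    altActA-odd : altActA σ a b (suc (double k)) ≡ nothing
    altActA-odd rewrite isEven-suc-double k = refl

    altActB-odd : altActB σ a b (suc (double k)) ≡
                  proj₂ σ a (suc (double k)) (altHistory σ a b (suc (double k)))
    altActB-odd rewrite isEven-suc-double k = refl

    altHistory-even : altHistory σ a b (suc (double k)) ≡
                      altActA σ a b (double k) ∷ altHistory σ a b (double k)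
    altHistory-even rewrite isEven-double k = refl

    altHistory-round : altHistory σ a b (double (suc k)) ≡
                       altActB σ a b (suc (double k)) ∷ altActA σ a b (double k) ∷ altHistory σ a b (double k)
    altHistory-round rewrite isEven-suc-double k | isEven-double k = refl

  speakers : ∀ {t} → SimHistory n t → AltHistory n t
  speakers [] = []
  speakers {suc t} ((x , y) ∷ h) = (if isEven t then x else y) ∷ speakers h

  simulateAlt : AltStrategy n → SimStrategy n
  simulateAlt σ = (λ b t h → if isEven t then proj₁ σ b t (speakers h) else nothing)
                , (λ a t h → if isEven t then nothing else proj₂ σ a t (speakers h))

  module _ (σ : AltStrategy n) (a b : Fin n) where

    speakers-simHistory : ∀ t → speakers (simHistory (simulateAlt σ) a b t) ≡ altHistory σ a b t
    speakers-simHistory zero = refl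
    speakers-simHistory (suc t) rewrite speakers-simHistory t with isEven t
    ... | true = refl
    ... | false = refl

    simActA-simulateAlt : ∀ t → simActA (simulateAlt σ) a b t ≡ altActA σ a b t
    simActA-simulateAlt t rewrite speakers-simHistory t with isEven t
    ... | true = refl
    ... | false = refl

    simActB-simulateAlt : ∀ t → simActB (simulateAlt σ) a b t ≡ altActB σ a b t
    simActB-simulateAlt t rewrite speakers-simHistory t with isEven t
    ... | true = refl
    ... | false = refl

  rounds : ∀ k → AltHistory n (double k) → SimHistory n k
  rounds zero [] = []
  rounds (suc k) (y ∷ x ∷ h) = (x , y) ∷ rounds k h

  -- Only consulted at the player's own parity; at odd steps the newest entry is
  -- A's move of the current round, which B must not see.
  onRounds : SimPlayerStrategy n → AltPlayerStrategy n
  onRounds s x t h with evenOdd t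
  ... | even k = s x k (rounds k h)
  ... | odd k = s x k (rounds k (tail h))

  interleave : SimStrategy n → AltStrategy n
  interleave σ = onRounds (proj₁ σ) , onRounds (proj₂ σ)

  module _ (σ : SimStrategy n) (a b : Fin n) where

    private
      τ : AltStrategy n
      τ = interleave σ

    rounds-altHistory : ∀ k → rounds k (altHistory τ a b (double k)) ≡ simHistory σ a b k
    altActA-interleave : ∀ k → altActA τ a b (double k) ≡ simActA σ a b k
    altActB-interleave : ∀ k → altActB τ a b (suc (double k)) ≡ simActB σ a b k

    rounds-altHistory zero = refl
    rounds-altHistory (suc k) = begin
      rounds (suc k) (altHistory τ a b (double (suc k)))
        ≡⟨ cong (rounds (suc k)) (altHistory-round τ a b k) ⟩
      (altActA τ a b (double k) , altActB τ a b (suc (double k))) ∷ rounds k (altHistory τ a b (double k))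
        ≡⟨ cong₂ _∷_ (cong₂ _,_ (altActA-interleave k) (altActB-interleave k)) (rounds-altHistory k) ⟩
      simHistory σ a b (suc k) ∎

    altActA-interleave k
      rewrite altActA-even τ a b k | evenOdd-double k | rounds-altHistory k = refl

    altActB-interleave k
      rewrite altActB-odd τ a b k | evenOdd-suc-double k
            | altHistory-even τ a b k | rounds-altHistory k = refl

  module _ (σ : SimStrategy n) where

    simActA⊑interleave : simActA σ ⊑ altActA (interleave σ)
    simActA⊑interleave = reindex⇒⊑ double λ a b k → sym (altActA-interleave σ a b k)

    simActB⊑interleave : simActB σ ⊑ altActB (interleave σ)
    simActB⊑interleave = reindex⇒⊑ (suc ∘ double) λ a b k → sym (altActB-interleave σ a b k)

    interleave⊑simActA : altActA (interleave σ) ⊑ simActA σ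
    interleave⊑simActA a b t v e with evenOdd t
    ... | even k = k , trans (sym (altActA-interleave σ a b k)) e
    ... | odd k = case trans (sym (altActA-odd (interleave σ) a b k)) e of λ ()

    interleave⊑simActB : altActB (interleave σ) ⊑ simActB σ
    interleave⊑simActB a b t v e with evenOdd t
    ... | even k = case trans (sym (altActB-even (interleave σ) a b k)) e of λ ()
    ... | odd k = k , trans (sym (altActB-interleave σ a b k)) e

proposition2p6 : (n : ℕ) (G : ConnectedSimpleGraph n) (S : Fin n → Fin n → Set) →
    IsPlacementSet G S →
    (SimSolvable G S → AltSolvable G S) × (AltSolvable G S → SimSolvable G S)
-- The equivalence holds for every S.
proposition2p6 n G S _ = sim⇒alt , alt⇒sim
  where
  sim⇒alt : SimSolvable G S → AltSolvable G S
  sim⇒alt (σ , truthful , live) =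
      interleave σ
    , Truthful-⊑ {G = G} (interleave⊑simActA σ) (interleave⊑simActB σ) truthful
    , Live-⊑ (simActA⊑interleave σ) (simActB⊑interleave σ) live

  alt⇒sim : AltSolvable G S → SimSolvable G S
  alt⇒sim (σ , truthful , live) =
      simulateAlt σ
    , Truthful-⊑ {G = G} (reindex⇒⊑ id (simActA-simulateAlt σ))
                         (reindex⇒⊑ id (simActB-simulateAlt σ)) truthful
    , Live-⊑ (reindex⇒⊑ id λ a b t → sym (simActA-simulateAlt σ a b t))
             (reindex⇒⊑ id λ a b t → sym (simActB-simulateAlt σ a b t)) live
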